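{- Let $\zeta$ be a position with $1,*\in\mathrm{cl}(\zeta)$. Then $*+*\not\equiv 0\pmod{\mathrm{cl}(\zeta)}$. Similarly, if $\overline{1},*\in\mathrm{cl}(\zeta)$, then $*+*\not\equiv 0\pmod{\mathrm{cl}(\zeta)}$.
   Context: A position $\xi=\{\xi^L \mid \xi^R\}$ is given recursively by finite sets of Left and Right options; $\cdot$ denotes an empty set. $0=\{\cdot\mid\cdot\}$, $*=\{0\mid 0\}$, $1=\{0\mid\cdot\}$, $\overline{1}=\{\cdot\mid 0\}$. Disjunctive sum: $\alpha+\beta=\{\alpha^L+\beta,\alpha+\beta^L \mid \alpha^R+\beta,\alpha+\beta^R\}$. Under misère play a player unable to move on their turn wins; $o^-$ denotes misère outcome ($\mathcal{L}$ Left wins always, $\mathcal{R}$ Right wins always, $\mathcal{N}$ next player wins, $\mathcal{P}$ next player loses). $\mathrm{cl}(\Upsilon)$ is the smallest set containing $\Upsilon$ closed under disjunctive sum and taking options. For a closed set $\Gamma$, $\alpha\equiv\beta\pmod\Gamma$ means $o^-(\alpha+\gamma)=o^-(\beta+\gamma)$ for all $\gamma\in\Gamma$. -}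

module Defs where

open import Data.List using (List; []; _∷_; _++_)
open import Data.List.Relation.Unary.All using (All)
open import Data.List.Relation.Unary.Any using (Any)
open import Data.Bool using (Bool; true; false; _∧_; _∨_; not)
open import Data.Product using (Σ; _×_)
open import Relation.Binary.PropositionalEquality using (_≡_)
open import Relation.Nullary using (¬_)

-- A position {ξᴸ | ξᴿ}: finite lists of Left and Right options
-- (lists represent finite sets; see _≅_ for identity of positions as sets).
data Game : Set where
  ⟨_∣_⟩ : List Game → List Game → Game

mutual
  data _≅_ : Game → Game → Set where
    same : ∀ {aL aR bL bR} → SameSet aL bL → SameSet aR bR → ⟨ aL ∣ aR ⟩ ≅ ⟨ bL ∣ bR ⟩

  data SameSet (xs ys : List Game) : Set where
    sameSet : All (λ x → Any (λ y → x ≅ y) ys) xs →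
              All (λ y → Any (λ x → x ≅ y) xs) ys → SameSet xs ys

zeroG : Game
zeroG = ⟨ [] ∣ [] ⟩

star : Game
star = ⟨ zeroG ∷ [] ∣ zeroG ∷ [] ⟩

oneG : Game
oneG = ⟨ zeroG ∷ [] ∣ [] ⟩

oneBar : Game
oneBar = ⟨ [] ∣ zeroG ∷ [] ⟩

mutual
  _⊕_ : Game → Game → Game
  a@(⟨ aL ∣ aR ⟩) ⊕ b@(⟨ bL ∣ bR ⟩) =
    ⟨ sumL aL b ++ sumR a bL ∣ sumL aR b ++ sumR a bR ⟩

  sumL : List Game → Game → List Game
  sumL [] b = []
  sumL (x ∷ xs) b = (x ⊕ b) ∷ sumL xs b

  sumR : Game → List Game → List Game
  sumR a [] = []
  sumR a (y ∷ ys) = (a ⊕ y) ∷ sumR a ys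

-- Misère play: a player unable to move on their turn wins.
-- leftFirst g  : Left, moving first in g, wins.
-- rightFirst g : Right, moving first in g, wins.
mutual
  leftFirst : Game → Bool
  leftFirst ⟨ [] ∣ aR ⟩ = true
  leftFirst ⟨ x ∷ xs ∣ aR ⟩ = anyRightLoses (x ∷ xs)

  rightFirst : Game → Bool
  rightFirst ⟨ aL ∣ [] ⟩ = true
  rightFirst ⟨ aL ∣ y ∷ ys ⟩ = anyLeftLoses (y ∷ ys)

  anyRightLoses : List Game → Bool
  anyRightLoses [] = false
  anyRightLoses (x ∷ xs) = not (rightFirst x) ∨ anyRightLoses xs

  anyLeftLoses : List Game → Bool
  anyLeftLoses [] = false
  anyLeftLoses (y ∷ ys) = not (leftFirst y) ∨ anyLeftLoses ys

data Outcome : Set where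
  𝓛 𝓡 𝓝 𝓟 : Outcome

outcomeOf : Bool → Bool → Outcome
outcomeOf true  true  = 𝓝
outcomeOf true  false = 𝓛
outcomeOf false true  = 𝓡
outcomeOf false false = 𝓟

o⁻ : Game → Outcome
o⁻ g = outcomeOf (leftFirst g) (rightFirst g)

-- cl(ζ): smallest set containing ζ, closed under disjunctive sum and options,
-- where positions are identified up to _≅_ (equality of option sets).
data Cl (ζ : Game) : Game → Set where
  base  : Cl ζ ζ
  plus  : ∀ {a b} → Cl ζ a → Cl ζ b → Cl ζ (a ⊕ b)
  optL  : ∀ {aL aR x} → Cl ζ ⟨ aL ∣ aR ⟩ → Any (λ y → x ≡ y) aL → Cl ζ x
  optR  : ∀ {aL aR x} → Cl ζ ⟨ aL ∣ aR ⟩ → Any (λ y → x ≡ y) aR → Cl ζ x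
  ident : ∀ {a b} → Cl ζ a → a ≅ b → Cl ζ b

EquivMod : Game → Game → Game → Set
EquivMod ζ α β = ∀ γ → Cl ζ γ → o⁻ (α ⊕ γ) ≡ o⁻ (β ⊕ γ)

-- The game
-- γ = 1 distinguishes * + * from 0: in 0 + 1 Right wins (Left must move to 0
-- and Right, unable to move, wins; Right moving first cannot move), whereas
-- * + * + 1 is a previous-player win.  Dually γ = 1̄ turns the Left win 0 + 1̄
-- into the 𝓟-position * + * + 1̄.  These four outcomes are finite game-tree
-- computations, checked by evaluation.
module Submission where

open import Defs
open import Data.Product using (_×_; _,_)
open import Relation.Nullary using (¬_)
open import Relation.Binary.PropositionalEquality using (_≡_; _≢_; refl; sym; trans)

distinguisher : ∀ {ζ} (α β γ : Game) → Cl ζ γ →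
  o⁻ (α ⊕ γ) ≢ o⁻ (β ⊕ γ) → ¬ EquivMod ζ α β
distinguisher α β γ γ∈Γ differ equiv = differ (equiv γ γ∈Γ)

outcome-0+1 : o⁻ (zeroG ⊕ oneG) ≡ 𝓡
outcome-0+1 = refl

outcome-*+*+1 : o⁻ ((star ⊕ star) ⊕ oneG) ≡ 𝓟
outcome-*+*+1 = refl

outcome-0+1̄ : o⁻ (zeroG ⊕ oneBar) ≡ 𝓛
outcome-0+1̄ = refl

outcome-*+*+1̄ : o⁻ ((star ⊕ star) ⊕ oneBar) ≡ 𝓟
outcome-*+*+1̄ = refl

one-separates : o⁻ ((star ⊕ star) ⊕ oneG) ≢ o⁻ (zeroG ⊕ oneG)
one-separates eq with trans (sym outcome-*+*+1) (trans eq outcome-0+1)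
... | ()

oneBar-separates : o⁻ ((star ⊕ star) ⊕ oneBar) ≢ o⁻ (zeroG ⊕ oneBar)
oneBar-separates eq with trans (sym outcome-*+*+1̄) (trans eq outcome-0+1̄)
... | ()

proposition4p1p1 : (ζ : Game) →
    (Cl ζ oneG × Cl ζ star → ¬ EquivMod ζ (star ⊕ star) zeroG) ×
    (Cl ζ oneBar × Cl ζ star → ¬ EquivMod ζ (star ⊕ star) zeroG)
proposition4p1p1 ζ =
  (λ { (1∈Γ , _) → distinguisher (star ⊕ star) zeroG oneG 1∈Γ one-separates }) ,
  (λ { (1̄∈Γ , _) → distinguisher (star ⊕ star) zeroG oneBar 1̄∈Γ oneBar-separates })
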